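{- Let $P=([n],\preceq)$ be a poset and $0\le r<m\le n$, and let $\lambda=|P^r|-r$. If there exists an $r$-perfect $P$-code $\mathcal{C}\subseteq F^n$ with $|\mathcal{C}|=2^{n-m}$, then $m-r<\lambda\le 2^{m-r+1}-2$.
   Context: $[n]=\{1,\dots,n\}$; subsets of $[n]$ are identified with their characteristic vectors in $F^n=\{0,1\}^n$, and $x+y$ is the symmetric difference. An ideal of $P$ is a set $I\subseteq[n]$ such that $a\in I$ and $b\preceq a$ imply $b\in I$; ${<}X{>}$ is the smallest ideal containing $X$. $\mathcal{I}_P^r$ is the set of ideals of cardinality $r$ and $P^r=\bigcup_{J\in\mathcal{I}_P^r}J$. The $P$-weight is $w_P(x)=|{<}x{>}|$ and $\mathcal{B}_P^r=\{x\in F^n: w_P(x)\le r\}$. A $P$-code $\mathcal{C}\subseteq F^n$ is $r$-perfect if every $x\in F^n$ has exactly one representation $x=c+b$ with $c\in\mathcal{C}$, $b\in\mathcal{B}_P^r$. -}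

module Defs where

open import Data.Nat using (ℕ; _≤_)
open import Data.Bool using (Bool; _xor_)
open import Data.Fin using (Fin)
open import Data.Fin.Subset using (Subset; _∈_; ∣_∣)
open import Data.Fin.Subset.Properties using (_∈?_)
open import Data.Fin.Properties using (any?)
open import Data.Vec using (Vec; tabulate; zipWith)
open import Data.List using (List)
import Data.List.Membership.Propositional as LM
open import Data.Product using (Σ; ∃; _×_; _,_)
open import Relation.Nullary using (does)
open import Relation.Nullary.Decidable using (_×-dec_)
open import Relation.Binary.Core using (Rel)
open import Relation.Binary.Definitions using (Decidable)
open import Relation.Binary.Structures using (IsPartialOrder)
open import Relation.Binary.PropositionalEquality using (_≡_)
open import Function.Bundles using (_⇔_)

record FinPoset (n : ℕ) : Set₁ where
  field
    _≼_            : Rel (Fin n) _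
    _≼?_           : Decidable _≼_
    isPartialOrder : IsPartialOrder _≡_ _≼_

-- F^n = {0,1}^n, identified with subsets of [n] (characteristic vectors).
Word : ℕ → Set
Word n = Subset n

_⊕_ : ∀ {n} → Word n → Word n → Word n
x ⊕ y = zipWith _xor_ x y

module _ {n : ℕ} (P : FinPoset n) where
  open FinPoset P

  IsIdeal : Subset n → Set
  IsIdeal I = ∀ a b → a ∈ I → b ≼ a → b ∈ I

  ⟨_⟩ : Subset n → Subset n
  ⟨ X ⟩ = tabulate (λ b → does (any? (λ a → (a ∈? X) ×-dec (b ≼? a))))

  wP : Word n → ℕ
  wP x = ∣ ⟨ x ⟩ ∣

  InBall : ℕ → Word n → Set
  InBall r b = wP b ≤ r

  IsPr : ℕ → Subset n → Set
  IsPr r S = ∀ i → (i ∈ S ⇔ ∃ (λ J → IsIdeal J × ∣ J ∣ ≡ r × i ∈ J))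

  IsPerfect : ℕ → List (Word n) → Set
  IsPerfect r C =
    (∀ x → Σ (Word n) λ c → Σ (Word n) λ b →
             c LM.∈ C × InBall r b × x ≡ c ⊕ b)
    × (∀ x c b c' b' → c LM.∈ C → InBall r b → x ≡ c ⊕ b
                      → c' LM.∈ C → InBall r b' → x ≡ c' ⊕ b'
                      → c ≡ c' × b ≡ b')

module Submission where

open import Defs
import Algebra.Properties.CommutativeSemigroup as CommutativeSemigroupProperties
import Algebra.Properties.Semiring.Sum as SemiringSum
open import Data.Bool using (true; false; if_then_else_; _∧_; _xor_)
open import Data.Bool.Properties using (xor-assoc; xor-same; ∧-zeroʳ)
open import Data.Fin using (Fin; zero; suc)
open import Data.Fin.Properties using (0≢1+n; suc-injective; any?; _≟_)
open import Data.Fin.Subset using (Subset; _∈_; _∉_; _⊆_; ∣_∣; _∪_; _─_; ⁅_⁆; ⊥; ⊤; inside; outside)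
open import Data.Fin.Subset.Properties
  using ( _∈?_; _⊆?_; ∉⊥; ∈⊤; ⊆⊤; ∣⊥∣≡0; ∣⊤∣≡n; x∈⁅x⁆; x∈⁅y⁆⇒x≡y; x∈p∪q⁺; x∈p∪q⁻; p⊆p∪q; p─q⊆p
        ; ∪-identityʳ; drop-∷-⊆; p⊆q⇒∣p∣≤∣q∣; p⊂q⇒∣p∣<∣q∣; ∣q∣≤∣p∪q∣ )
open import Data.List using (List; []; _∷_; map; length)
open import Data.List.Membership.Propositional using () renaming (_∈_ to _∈ₗ_)
open import Data.List.Relation.Unary.All as All using ()
open import Data.List.Relation.Unary.AllPairs using (_∷_)
open import Data.List.Relation.Unary.Any as Any using ()
open import Data.List.Relation.Unary.Unique.Propositional using (Unique)
open import Data.Nat using (ℕ; zero; suc; _≤_; _<_; _≤?_; _+_; _*_; _^_; _∸_; z≤n; s≤s; z<s)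
open import Data.Nat.Induction using (<-wellFounded)
open import Data.Nat.ListAction using (sum)
open import Data.Nat.Properties
  using ( +-commutativeSemigroup; +-*-semiring; module ≤-Reasoning
        ; ≤-reflexive; ≤-trans; <⇒≤; <⇒≱; ≰⇒>; <-≤-trans
        ; +-assoc; +-comm; +-suc; +-identityʳ; *-identityˡ; *-distribˡ-+; *-distribʳ-+
        ; +-mono-≤; +-monoʳ-≤; +-mono-<-≤; +-mono-≤-<; *-monoʳ-≤; m<m+n
        ; *-cancelˡ-≡; *-cancelʳ-≤; m^n≢0; ^-distribˡ-+-*; ^-monoʳ-≤; ^-monoʳ-<
        ; m+[n∸m]≡n; m∸n+n≡m; m+n∸n≡m; m+n≤o⇒m≤o∸n; ∸-monoˡ-< )
open import Data.Product using (∃; _×_; _,_; proj₁; proj₂)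
open import Data.Sum using (inj₁; inj₂; [_,_]′)
open import Data.Vec using ([]; _∷_; here; there)
open import Data.Vec.Properties using (lookup∘tabulate; lookup⇒[]=; []=⇒lookup)
open import Function using (_∘_; id)
open import Function.Bundles using (Equivalence)
open import Induction.WellFounded using (Acc; acc)
open import Level using (Level)
open import Relation.Binary.PropositionalEquality
  using (_≡_; _≢_; refl; sym; trans; cong; cong₂; subst; module ≡-Reasoning)
open import Relation.Binary.Structures using (IsPartialOrder)
open import Relation.Nullary using (Dec; yes; no; does; ¬_; contradiction)
open import Relation.Nullary.Decidable using (_×-dec_; ¬?; dec-true; dec-false; decidable-stable)
open import Relation.Unary using (Decidable)

open SemiringSum +-*-semiring using (sum-syntax; *-distribˡ-sum; *-distribʳ-sum)
open CommutativeSemigroupProperties +-commutativeSemigroup using (interchange)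

-- Write B for the ball B_P^r and λ = |P^r| - r. A perfect code with 2^(n-m) words tiles F^n by
-- translates of B, so |B| = 2^m. Every word of weight at most r generates an ideal that extends to
-- an ideal of size r, so B consists of subsets of P^r, and the inclusion is strict: either P^r
-- itself is not in B, or |P^r| <= r < m. Hence m < |P^r|.
--
-- For the upper bound fix an ideal J of size r. For each i in P^r \ J, the down-set of i extends
-- inside (down-set of i) ∪ J to an ideal Q_i of size r; the 2^(r-1) subsets of Q_i containing i lie
-- in B, and each contains i while all its elements outside J lie below i. So these families, for
-- the λ choices of i, are disjoint from each other and from the 2^r subsets of J, all inside B:
-- 2^(r+1) + λ 2^r <= 2|B| = 2^(m+1), which also covers r = 0.

private
  variable
    a b : Level
    A : Set a
    B : Set b
    n k : ℕ
    f g : Word n → ℕ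

𝟙 : Dec A → ℕ
𝟙 a? = if does a? then 1 else 0

𝟙-yes : (a? : Dec A) → A → 𝟙 a? ≡ 1
𝟙-yes a? a rewrite dec-true a? a = refl

𝟙-no : (a? : Dec A) → ¬ A → 𝟙 a? ≡ 0
𝟙-no a? ¬a rewrite dec-false a? ¬a = refl

𝟙*-≤ : ∀ (a? : Dec A) {k m} → (A → k ≤ m) → 𝟙 a? * k ≤ m
𝟙*-≤ (yes a) {k} k≤m = ≤-trans (≤-reflexive (*-identityˡ k)) (k≤m a)
𝟙*-≤ (no _)      _   = z≤n

𝟙-mono : (a? : Dec A) (b? : Dec B) → (A → B) → 𝟙 a? ≤ 𝟙 b?
𝟙-mono (yes a) b? f = ≤-reflexive (sym (𝟙-yes b? (f a)))
𝟙-mono (no _)  b? f = z≤n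

⊕-cancelˡ : (c x : Word n) → c ⊕ (c ⊕ x) ≡ x
⊕-cancelˡ []      []      = refl
⊕-cancelˡ (b ∷ c) (a ∷ x) =
  cong₂ _∷_ (trans (sym (xor-assoc b b a)) (cong (λ z → z xor a) (xor-same b))) (⊕-cancelˡ c x)

sumWords : ∀ n → (Word n → ℕ) → ℕ
sumWords zero    f = f []
sumWords (suc n) f = sumWords n (f ∘ (false ∷_)) + sumWords n (f ∘ (true ∷_))

sumWords-cong : (∀ x → f x ≡ g x) → sumWords n f ≡ sumWords n g
sumWords-cong {n = zero}  f≗g = f≗g []
sumWords-cong {n = suc n} f≗g =
  cong₂ _+_ (sumWords-cong (f≗g ∘ (false ∷_))) (sumWords-cong (f≗g ∘ (true ∷_)))

sumWords-mono-≤ : (∀ x → f x ≤ g x) → sumWords n f ≤ sumWords n g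
sumWords-mono-≤ {n = zero}  f≤g = f≤g []
sumWords-mono-≤ {n = suc n} f≤g =
  +-mono-≤ (sumWords-mono-≤ (f≤g ∘ (false ∷_))) (sumWords-mono-≤ (f≤g ∘ (true ∷_)))

sumWords-mono-< : (∀ x → f x ≤ g x) → ∀ y → f y < g y → sumWords n f < sumWords n g
sumWords-mono-< {n = zero}  f≤g [] fy<gy = fy<gy
sumWords-mono-< {n = suc n} f≤g (false ∷ y) fy<gy =
  +-mono-<-≤ (sumWords-mono-< (f≤g ∘ (false ∷_)) y fy<gy) (sumWords-mono-≤ (f≤g ∘ (true ∷_)))
sumWords-mono-< {n = suc n} f≤g (true ∷ y) fy<gy =
  +-mono-≤-< (sumWords-mono-≤ (f≤g ∘ (false ∷_))) (sumWords-mono-< (f≤g ∘ (true ∷_)) y fy<gy)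

sumWords-distrib-+ : ∀ n (f g : Word n → ℕ) →
  sumWords n (λ x → f x + g x) ≡ sumWords n f + sumWords n g
sumWords-distrib-+ zero    f g = refl
sumWords-distrib-+ (suc n) f g =
  trans (cong₂ _+_ (sumWords-distrib-+ n _ _) (sumWords-distrib-+ n _ _))
        (interchange (sumWords n (f ∘ (false ∷_))) (sumWords n (g ∘ (false ∷_)))
                     (sumWords n (f ∘ (true ∷_))) (sumWords n (g ∘ (true ∷_))))

sumWords-zero : ∀ n → sumWords n (λ _ → 0) ≡ 0
sumWords-zero zero    = refl
sumWords-zero (suc n) = cong₂ _+_ (sumWords-zero n) (sumWords-zero n)

sumWords-one : ∀ n → sumWords n (λ _ → 1) ≡ 2 ^ n
sumWords-one zero    = refl
sumWords-one (suc n) = cong₂ _+_ (sumWords-one n) (trans (sumWords-one n) (sym (+-identityʳ _)))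

sumWords-⊕ : ∀ (f : Word n → ℕ) c → sumWords n (f ∘ (c ⊕_)) ≡ sumWords n f
sumWords-⊕ f []          = refl
sumWords-⊕ f (false ∷ c) = cong₂ _+_ (sumWords-⊕ _ c) (sumWords-⊕ _ c)
sumWords-⊕ {suc n} f (true ∷ c) =
  trans (cong₂ _+_ (sumWords-⊕ (f ∘ (true ∷_)) c) (sumWords-⊕ (f ∘ (false ∷_)) c))
        (+-comm (sumWords n (f ∘ (true ∷_))) _)

sumWords-sum-comm : ∀ (C : List B) (f : B → Word n → ℕ) →
  sumWords n (λ x → sum (map (λ c → f c x) C)) ≡ sum (map (λ c → sumWords n (f c)) C)
sumWords-sum-comm {n = n} []      f = sumWords-zero n
sumWords-sum-comm {n = n} (c ∷ C) f =
  trans (sumWords-distrib-+ n (f c) _) (cong (sumWords n (f c) +_) (sumWords-sum-comm C f))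

sumWords-∑-comm : ∀ (f : Fin k → Word n → ℕ) →
  sumWords n (λ x → ∑[ i < k ] f i x) ≡ ∑[ i < k ] sumWords n (f i)
sumWords-∑-comm {k = zero}  {n} f = sumWords-zero n
sumWords-∑-comm {k = suc k} {n} f =
  trans (sumWords-distrib-+ n (f zero) _) (cong (sumWords n (f zero) +_) (sumWords-∑-comm (f ∘ suc)))

sumWords-⊆ : ∀ (S : Subset n) → sumWords n (λ x → 𝟙 (x ⊆? S)) ≡ 2 ^ ∣ S ∣
sumWords-⊆         []            = refl
sumWords-⊆         (inside  ∷ S) = cong₂ _+_ (sumWords-⊆ S) (trans (sumWords-⊆ S) (sym (+-identityʳ _)))
sumWords-⊆ {suc n} (outside ∷ S) = trans (cong₂ _+_ (sumWords-⊆ S) (sumWords-zero n)) (+-identityʳ _)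

sumWords-∋-⊆ : ∀ {i} (S : Subset n) → i ∈ S →
  2 * sumWords n (λ x → 𝟙 ((i ∈? x) ×-dec (x ⊆? S))) ≡ 2 ^ ∣ S ∣
sumWords-∋-⊆ {suc n} {zero} (inside ∷ S) here =
  cong (2 *_) (trans (cong (_+ sumWords n (λ x → 𝟙 (x ⊆? S))) (sumWords-zero n)) (sumWords-⊆ S))
sumWords-∋-⊆ {suc n} {suc i} (inside ∷ S) (there i∈S) = begin
  2 * (N + N)           ≡⟨ *-distribˡ-+ 2 N N ⟩
  2 * N + 2 * N         ≡⟨ cong₂ _+_ (sumWords-∋-⊆ S i∈S) (sumWords-∋-⊆ S i∈S) ⟩
  2 ^ ∣ S ∣ + 2 ^ ∣ S ∣ ≡⟨ cong (2 ^ ∣ S ∣ +_) (+-identityʳ _) ⟨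
  2 ^ suc ∣ S ∣         ∎
  where
  open ≡-Reasoning
  N : ℕ
  N = sumWords n (λ x → 𝟙 ((i ∈? x) ×-dec (x ⊆? S)))
sumWords-∋-⊆ {suc n} {suc i} (outside ∷ S) (there i∈S) = begin
  2 * (N + sumWords n (λ x → if does (i ∈? x) ∧ false then 1 else 0)) ≡⟨ cong (λ z → 2 * (N + z)) none ⟩
  2 * (N + 0)                                                          ≡⟨ cong (2 *_) (+-identityʳ N) ⟩
  2 * N                                                                ≡⟨ sumWords-∋-⊆ S i∈S ⟩
  2 ^ ∣ S ∣                                                            ∎
  where
  open ≡-Reasoning
  N : ℕ
  N = sumWords n (λ x → 𝟙 ((i ∈? x) ×-dec (x ⊆? S)))
  none : sumWords n (λ x → if does (i ∈? x) ∧ false then 1 else 0) ≡ 0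
  none = trans (sumWords-cong (λ x → cong (λ b → if b then 1 else 0) (∧-zeroʳ (does (i ∈? x)))))
               (sumWords-zero n)

∣p∣≡∑𝟙∈ : ∀ (p : Subset n) → ∣ p ∣ ≡ ∑[ i < n ] 𝟙 (i ∈? p)
∣p∣≡∑𝟙∈ []            = refl
∣p∣≡∑𝟙∈ (inside ∷ p)  = cong suc (∣p∣≡∑𝟙∈ p)
∣p∣≡∑𝟙∈ (outside ∷ p) = ∣p∣≡∑𝟙∈ p

∑-mono-≤ : ∀ {f g : Fin k → ℕ} → (∀ i → f i ≤ g i) → ∑[ i < k ] f i ≤ ∑[ i < k ] g i
∑-mono-≤ {zero}  _   = z≤n
∑-mono-≤ {suc k} f≤g = +-mono-≤ (f≤g zero) (∑-mono-≤ (f≤g ∘ suc))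

∑-𝟙-none : ∀ {A : Fin k → Set a} (A? : ∀ i → Dec (A i)) →
  (∀ i → ¬ A i) → ∑[ i < k ] 𝟙 (A? i) ≡ 0
∑-𝟙-none {zero}  A? ¬A = refl
∑-𝟙-none {suc k} A? ¬A = cong₂ _+_ (𝟙-no (A? zero) (¬A zero)) (∑-𝟙-none (A? ∘ suc) (¬A ∘ suc))

∑-𝟙-exclusive : ∀ {A : Fin k → Set a} (A? : ∀ i → Dec (A i)) (b? : Dec B) →
  (∀ i j → A i → A j → i ≡ j) → (∀ i → A i → B) → ∑[ i < k ] 𝟙 (A? i) ≤ 𝟙 b?
∑-𝟙-exclusive {zero}  A? b? exclusive A⇒B = z≤n
∑-𝟙-exclusive {suc k} A? b? exclusive A⇒B with A? zero
... | yes A₀ = begin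
  1 + ∑[ i < k ] 𝟙 (A? (suc i)) ≡⟨ cong suc (∑-𝟙-none (A? ∘ suc) (λ i → 0≢1+n ∘ exclusive _ _ A₀)) ⟩
  1                              ≡⟨ 𝟙-yes b? (A⇒B zero A₀) ⟨
  𝟙 b?                           ∎
  where open ≤-Reasoning
... | no _ = ∑-𝟙-exclusive (A? ∘ suc) b? (λ i j Aᵢ Aⱼ → suc-injective (exclusive _ _ Aᵢ Aⱼ)) (A⇒B ∘ suc)

sum-map-const : ∀ (C : List B) {f : B → ℕ} {k} → (∀ c → f c ≡ k) → sum (map f C) ≡ length C * k
sum-map-const []      f≡k = refl
sum-map-const (c ∷ C) f≡k = cong₂ _+_ (f≡k c) (sum-map-const C f≡k)

sum-𝟙-none : ∀ {C : List B} {A : B → Set a} (A? : ∀ c → Dec (A c)) →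
  (∀ {c} → c ∈ₗ C → ¬ A c) → sum (map (𝟙 ∘ A?) C) ≡ 0
sum-𝟙-none {C = []}    A? ¬A = refl
sum-𝟙-none {C = c ∷ C} A? ¬A =
  cong₂ _+_ (𝟙-no (A? c) (¬A (Any.here refl))) (sum-𝟙-none A? (¬A ∘ Any.there))

sum-𝟙-unique : ∀ {C : List B} {A : B → Set a} (A? : ∀ c → Dec (A c)) → Unique C →
  (∀ {c c′} → c ∈ₗ C → c′ ∈ₗ C → A c → A c′ → c ≡ c′) →
  (∃ λ c → c ∈ₗ C × A c) → sum (map (𝟙 ∘ A?) C) ≡ 1
sum-𝟙-unique {C = c ∷ C} A? (c∉C ∷ unique) A-unique (w , w∈ , Aw) with A? c
... | yes Ac = cong suc (sum-𝟙-none A? λ c′∈C Ac′ →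
                 All.lookup c∉C c′∈C (A-unique (Any.here refl) (Any.there c′∈C) Ac Ac′))
... | no ¬Ac with w∈
...   | Any.here refl   = contradiction Aw ¬Ac
...   | Any.there w∈C =
  sum-𝟙-unique A? unique (λ p q → A-unique (Any.there p) (Any.there q)) (w , w∈C , Aw)

∣p∣<∣q∣⇒∃x∈q∖p : ∀ {p q : Subset n} → ∣ p ∣ < ∣ q ∣ → ∃ λ x → x ∈ q × x ∉ p
∣p∣<∣q∣⇒∃x∈q∖p {p = p} {q} ∣p∣<∣q∣ with any? (λ x → (x ∈? q) ×-dec ¬? (x ∈? p))
... | yes x∈q∖p = x∈q∖p
... | no  q⊈p  = contradiction (p⊆q⇒∣p∣≤∣q∣ q⊆p) (<⇒≱ ∣p∣<∣q∣)
  where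
  q⊆p : q ⊆ p
  q⊆p {x} x∈q = decidable-stable (x ∈? p) (λ x∉p → q⊈p (x , x∈q , x∉p))

∣p∪⁅x⁆∣≡1+∣p∣ : ∀ {p : Subset n} {x} → x ∉ p → ∣ p ∪ ⁅ x ⁆ ∣ ≡ suc ∣ p ∣
∣p∪⁅x⁆∣≡1+∣p∣ {p = outside ∷ p} {zero}  _   = cong (suc ∘ ∣_∣) (∪-identityʳ p)
∣p∪⁅x⁆∣≡1+∣p∣ {p = inside  ∷ p} {zero}  x∉p = contradiction here x∉p
∣p∪⁅x⁆∣≡1+∣p∣ {p = outside ∷ p} {suc x} x∉p = ∣p∪⁅x⁆∣≡1+∣p∣ (x∉p ∘ there)
∣p∪⁅x⁆∣≡1+∣p∣ {p = inside  ∷ p} {suc x} x∉p = cong suc (∣p∪⁅x⁆∣≡1+∣p∣ (x∉p ∘ there))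

x∈p⇒⁅x⁆⊆p : ∀ {p : Subset n} {x} → x ∈ p → ⁅ x ⁆ ⊆ p
x∈p⇒⁅x⁆⊆p {x = x} x∈p y∈⁅x⁆ = subst (_∈ _) (sym (x∈⁅y⁆⇒x≡y x y∈⁅x⁆)) x∈p

p⊆r∧x∈r⇒p∪⁅x⁆⊆r : ∀ {p r : Subset n} {x} → p ⊆ r → x ∈ r → p ∪ ⁅ x ⁆ ⊆ r
p⊆r∧x∈r⇒p∪⁅x⁆⊆r {p = p} {x = x} p⊆r x∈r y∈ = [ p⊆r , x∈p⇒⁅x⁆⊆p x∈r ]′ (x∈p∪q⁻ p ⁅ x ⁆ y∈)

x∈p─q⇒x∉q : ∀ {p q : Subset n} {x} → x ∈ p ─ q → x ∉ q
x∈p─q⇒x∉q {p = inside ∷ p}  {outside ∷ q} here        ()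
x∈p─q⇒x∉q {p = _ ∷ p}       {_ ∷ q}       (there x∈) (there x∈q) = x∈p─q⇒x∉q x∈ x∈q

∣p─q∣+∣q∣≡∣p∣ : ∀ (p q : Subset n) → q ⊆ p → ∣ p ─ q ∣ + ∣ q ∣ ≡ ∣ p ∣
∣p─q∣+∣q∣≡∣p∣ []            []            _   = refl
∣p─q∣+∣q∣≡∣p∣ (inside  ∷ p) (inside  ∷ q) q⊆p =
  trans (+-suc _ _) (cong suc (∣p─q∣+∣q∣≡∣p∣ p q (drop-∷-⊆ q⊆p)))
∣p─q∣+∣q∣≡∣p∣ (inside  ∷ p) (outside ∷ q) q⊆p = cong suc (∣p─q∣+∣q∣≡∣p∣ p q (drop-∷-⊆ q⊆p))
∣p─q∣+∣q∣≡∣p∣ (outside ∷ p) (inside  ∷ q) q⊆p = contradiction (q⊆p here) λ ()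
∣p─q∣+∣q∣≡∣p∣ (outside ∷ p) (outside ∷ q) q⊆p = ∣p─q∣+∣q∣≡∣p∣ p q (drop-∷-⊆ q⊆p)

module _ (P : FinPoset n) where
  open FinPoset P
  open IsPartialOrder isPartialOrder using (antisym) renaming (refl to ≼-refl; trans to ≼-trans)

  ↓_ : Subset n → Subset n
  ↓ X = ⟨_⟩ P X

  ∈↓⁺ : ∀ {X i j} → j ∈ X → i ≼ j → i ∈ ↓ X
  ∈↓⁺ {X} {i} j∈X i≼j =
    lookup⇒[]= i (↓ X) (trans (lookup∘tabulate _ i)
                              (dec-true (any? (λ k → (k ∈? X) ×-dec (i ≼? k))) (_ , j∈X , i≼j)))

  ∈↓⁻ : ∀ {X i} → i ∈ ↓ X → ∃ λ j → j ∈ X × i ≼ j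
  ∈↓⁻ {X} {i} i∈↓X with any? (λ j → (j ∈? X) ×-dec (i ≼? j)) in eq
  ... | yes below = below
  ... | no  _     with () ← trans (sym ([]=⇒lookup i∈↓X)) (trans (lookup∘tabulate _ i) (cong does eq))

  ↓-isIdeal : ∀ X → IsIdeal P (↓ X)
  ↓-isIdeal X i j i∈↓X j≼i with ∈↓⁻ i∈↓X
  ... | k , k∈X , i≼k = ∈↓⁺ k∈X (≼-trans j≼i i≼k)

  X⊆↓X : ∀ {X} → X ⊆ ↓ X
  X⊆↓X i∈X = ∈↓⁺ i∈X ≼-refl

  ↓-least : ∀ {X I} → IsIdeal P I → X ⊆ I → ↓ X ⊆ I
  ↓-least I-ideal X⊆I i∈↓X with ∈↓⁻ i∈↓X
  ... | j , j∈X , i≼j = I-ideal _ _ (X⊆I j∈X) i≼j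

  ∈↓⁅⁆⁻ : ∀ {i j} → i ∈ ↓ ⁅ j ⁆ → i ≼ j
  ∈↓⁅⁆⁻ {i} {j} i∈↓j with ∈↓⁻ i∈↓j
  ... | k , k∈⁅j⁆ , i≼k = subst (i ≼_) (x∈⁅y⁆⇒x≡y j k∈⁅j⁆) i≼k

  ∣↓⁅⁆∣-strictMono : ∀ {i j} → i ≼ j → i ≢ j → ∣ ↓ ⁅ i ⁆ ∣ < ∣ ↓ ⁅ j ⁆ ∣
  ∣↓⁅⁆∣-strictMono {i} {j} i≼j i≢j = p⊂q⇒∣p∣<∣q∣
    ( (λ k∈↓i → ∈↓⁺ (x∈⁅x⁆ j) (≼-trans (∈↓⁅⁆⁻ k∈↓i) i≼j))
    , j , ∈↓⁺ (x∈⁅x⁆ j) ≼-refl , (λ j∈↓i → i≢j (antisym i≼j (∈↓⁅⁆⁻ j∈↓i))))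

  wP≤∣ideal∣ : ∀ {x I} → IsIdeal P I → x ⊆ I → wP P x ≤ ∣ I ∣
  wP≤∣ideal∣ I-ideal x⊆I = p⊆q⇒∣p∣≤∣q∣ (↓-least I-ideal x⊆I)

  ∪-isIdeal : ∀ {I K} → IsIdeal P I → IsIdeal P K → IsIdeal P (I ∪ K)
  ∪-isIdeal {I} {K} I-ideal K-ideal i j i∈I∪K j≼i with x∈p∪q⁻ I K i∈I∪K
  ... | inj₁ i∈I = x∈p∪q⁺ (inj₁ (I-ideal i j i∈I j≼i))
  ... | inj₂ i∈K = x∈p∪q⁺ (inj₂ (K-ideal i j i∈K j≼i))

  ⊥-isIdeal : IsIdeal P ⊥
  ⊥-isIdeal _ _ i∈⊥ _ = contradiction i∈⊥ ∉⊥

  ⊤-isIdeal : IsIdeal P ⊤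
  ⊤-isIdeal _ _ _ _ = ∈⊤

  ∃-minimal : ∀ {S : Fin n → Set a} → Decidable S → ∀ {i} → S i →
            ∃ λ j → S j × (∀ k → S k → k ≼ j → k ≡ j)
  ∃-minimal {S = S} S? {i} = go i (<-wellFounded ∣ ↓ ⁅ i ⁆ ∣)
    where
    go : ∀ i → Acc _<_ ∣ ↓ ⁅ i ⁆ ∣ → S i → ∃ λ j → S j × (∀ k → S k → k ≼ j → k ≡ j)
    go i (acc rs) Sᵢ with any? (λ k → S? k ×-dec (k ≼? i) ×-dec ¬? (k ≟ i))
    ... | yes (k , Sₖ , k≼i , k≢i) = go k (rs (∣↓⁅⁆∣-strictMono k≼i k≢i)) Sₖ
    ... | no  none                 =
      i , Sᵢ , λ k Sₖ k≼i → decidable-stable (k ≟ i) (λ k≢i → none (k , Sₖ , k≼i , k≢i))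

  ∪⁅minimal⁆-isIdeal : ∀ {I K j} → IsIdeal P I → IsIdeal P K → j ∈ K →
    (∀ k → k ∈ K → k ∉ I → k ≼ j → k ≡ j) → IsIdeal P (I ∪ ⁅ j ⁆)
  ∪⁅minimal⁆-isIdeal {I} {K} {j} I-ideal K-ideal j∈K j-minimal i k i∈ k≼i with x∈p∪q⁻ I ⁅ j ⁆ i∈
  ... | inj₁ i∈I = x∈p∪q⁺ (inj₁ (I-ideal i k i∈I k≼i))
  ... | inj₂ i∈⁅j⁆ with k ∈? I
  ...   | yes k∈I = x∈p∪q⁺ (inj₁ k∈I)
  ...   | no  k∉I = x∈p∪q⁺ (inj₂ (subst (_∈ ⁅ j ⁆) (sym (j-minimal k k∈K k∉I k≼j)) (x∈⁅x⁆ j)))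
    where
    k≼j : k ≼ j
    k≼j = subst (k ≼_) (x∈⁅y⁆⇒x≡y j i∈⁅j⁆) k≼i
    k∈K : k ∈ K
    k∈K = K-ideal j k j∈K k≼j

  intermediate-ideal : ∀ {I K r} → IsIdeal P I → IsIdeal P K → I ⊆ K → ∣ I ∣ ≤ r → r ≤ ∣ K ∣ →
           ∃ λ J → IsIdeal P J × I ⊆ J × J ⊆ K × ∣ J ∣ ≡ r
  intermediate-ideal {I} {K} {r} I-ideal K-ideal I⊆K ∣I∣≤r r≤∣K∣ =
    go (r ∸ ∣ I ∣) I-ideal I⊆K (m+[n∸m]≡n ∣I∣≤r)
    where
    go : ∀ {I} d → IsIdeal P I → I ⊆ K → ∣ I ∣ + d ≡ r →
         ∃ λ J → IsIdeal P J × I ⊆ J × J ⊆ K × ∣ J ∣ ≡ r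
    go zero I-ideal I⊆K ∣I∣+0≡r = _ , I-ideal , id , I⊆K , trans (sym (+-identityʳ _)) ∣I∣+0≡r
    go {I} (suc d) I-ideal I⊆K ∣I∣+1+d≡r
      with ∣p∣<∣q∣⇒∃x∈q∖p (<-≤-trans (m<m+n ∣ I ∣ z<s) (subst (_≤ ∣ K ∣) (sym ∣I∣+1+d≡r) r≤∣K∣))
    ... | i , i∈K∖I
      with ∃-minimal (λ k → (k ∈? K) ×-dec ¬? (k ∈? I)) i∈K∖I
    ... | j , (j∈K , j∉I) , j-minimal
      with go d (∪⁅minimal⁆-isIdeal I-ideal K-ideal j∈K (λ k k∈K k∉I → j-minimal k (k∈K , k∉I)))
                 (p⊆r∧x∈r⇒p∪⁅x⁆⊆r I⊆K j∈K)
                 (trans (cong (_+ d) (∣p∪⁅x⁆∣≡1+∣p∣ j∉I)) (trans (sym (+-suc _ d)) ∣I∣+1+d≡r))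
    ... | J , J-ideal , I∪j⊆J , J⊆K , ∣J∣≡r = J , J-ideal , I∪j⊆J ∘ x∈p∪q⁺ ∘ inj₁ , J⊆K , ∣J∣≡r

ballSize : FinPoset n → ℕ → ℕ
ballSize {n} P r = sumWords n (λ x → 𝟙 (wP P x ≤? r))

module _ (P : FinPoset n) (r : ℕ) where

  perfect⇒length*ballSize≡2^n : ∀ {C} → Unique C → IsPerfect P r C →
                                length C * ballSize P r ≡ 2 ^ n
  perfect⇒length*ballSize≡2^n {C} unique (cover , disjoint) = begin
    length C * ballSize P r
      ≡⟨ sum-map-const C (sumWords-⊕ inBall) ⟨
    sum (map (λ c → sumWords n (λ x → inBall (c ⊕ x))) C)
      ≡⟨ sumWords-sum-comm C (λ c x → inBall (c ⊕ x)) ⟨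
    sumWords n (λ x → sum (map (λ c → inBall (c ⊕ x)) C))
      ≡⟨ sumWords-cong one-codeword-nearby ⟩
    sumWords n (λ _ → 1)
      ≡⟨ sumWords-one n ⟩
    2 ^ n
      ∎
    where
    open ≡-Reasoning
    inBall : Word n → ℕ
    inBall x = 𝟙 (wP P x ≤? r)
    one-codeword-nearby : ∀ x → sum (map (λ c → inBall (c ⊕ x)) C) ≡ 1
    one-codeword-nearby x = sum-𝟙-unique (λ c → wP P (c ⊕ x) ≤? r) unique
      (λ c∈C c′∈C c⊕x∈B c′⊕x∈B → proj₁ (disjoint x _ _ _ _
         c∈C c⊕x∈B (sym (⊕-cancelˡ _ x)) c′∈C c′⊕x∈B (sym (⊕-cancelˡ _ x))))
      (let c , b , c∈C , b∈B , x≡c⊕b = cover x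
       in c , c∈C , subst (λ y → wP P y ≤ r) (sym (trans (cong (c ⊕_) x≡c⊕b) (⊕-cancelˡ c b))) b∈B)

  perfect⇒ballSize≡2^m : ∀ {m C} → m ≤ n → Unique C → length C ≡ 2 ^ (n ∸ m) → IsPerfect P r C →
                         ballSize P r ≡ 2 ^ m
  perfect⇒ballSize≡2^m {m} {C} m≤n unique ∣C∣≡2^[n∸m] perfect =
    *-cancelˡ-≡ (ballSize P r) (2 ^ m) (2 ^ (n ∸ m)) {{m^n≢0 2 (n ∸ m)}} (begin
      2 ^ (n ∸ m) * ballSize P r ≡⟨ cong (_* ballSize P r) ∣C∣≡2^[n∸m] ⟨
      length C * ballSize P r    ≡⟨ perfect⇒length*ballSize≡2^n unique perfect ⟩
      2 ^ n                      ≡⟨ cong (2 ^_) (m∸n+n≡m m≤n) ⟨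
      2 ^ (n ∸ m + m)            ≡⟨ ^-distribˡ-+-* 2 (n ∸ m) m ⟩
      2 ^ (n ∸ m) * 2 ^ m        ∎)
    where open ≡-Reasoning

module _ (P : FinPoset n) {r : ℕ} {Pr : Subset n} (isPr : IsPr P r Pr) where
  open FinPoset P using (_≼_)

  ideal⊆Pr : ∀ {J} → IsIdeal P J → ∣ J ∣ ≡ r → J ⊆ Pr
  ideal⊆Pr J-ideal ∣J∣≡r {i} i∈J = Equivalence.from (isPr i) (_ , J-ideal , ∣J∣≡r , i∈J)

  ∈Pr⇒∣↓⁅⁆∣≤r : ∀ {i} → i ∈ Pr → ∣ (↓ P) ⁅ i ⁆ ∣ ≤ r
  ∈Pr⇒∣↓⁅⁆∣≤r {i} i∈Pr with Equivalence.to (isPr i) i∈Pr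
  ... | J , J-ideal , ∣J∣≡r , i∈J =
    subst (_ ≤_) ∣J∣≡r (wP≤∣ideal∣ P J-ideal (x∈p⇒⁅x⁆⊆p i∈J))

  module _ {J} (J-ideal : IsIdeal P J) (∣J∣≡r : ∣ J ∣ ≡ r) where
    open IsPartialOrder (FinPoset.isPartialOrder P) using (antisym)

    AnchoredAt : Fin n → Word n → Set
    AnchoredAt i x = i ∈ Pr ─ J × i ∈ x × x ⊆ (↓ P) ⁅ i ⁆ ∪ J × wP P x ≤ r

    anchoredAt? : ∀ i x → Dec (AnchoredAt i x)
    anchoredAt? i x = (i ∈? Pr ─ J) ×-dec (i ∈? x) ×-dec (x ⊆? (↓ P) ⁅ i ⁆ ∪ J) ×-dec (wP P x ≤? r)

    ⊆J⇒wP≤r : ∀ {x} → x ⊆ J → wP P x ≤ r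
    ⊆J⇒wP≤r x⊆J = subst (_ ≤_) ∣J∣≡r (wP≤∣ideal∣ P J-ideal x⊆J)

    anchor-unique : ∀ {x} i j → AnchoredAt i x → AnchoredAt j x → i ≡ j
    anchor-unique i j (i∈T , i∈x , x⊆↓i∪J , _) (j∈T , j∈x , x⊆↓j∪J , _) =
      antisym (below i∈T (x⊆↓j∪J i∈x)) (below j∈T (x⊆↓i∪J j∈x))
      where
      below : ∀ {i j} → i ∈ Pr ─ J → i ∈ (↓ P) ⁅ j ⁆ ∪ J → i ≼ j
      below i∈T i∈↓j∪J with x∈p∪q⁻ _ J i∈↓j∪J
      ... | inj₁ i∈↓j = ∈↓⁅⁆⁻ P i∈↓j
      ... | inj₂ i∈J  = contradiction i∈J (x∈p─q⇒x∉q i∈T)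

    packing : ∀ x → 𝟙 (x ⊆? J) + ∑[ i < n ] 𝟙 (anchoredAt? i x) ≤ 𝟙 (wP P x ≤? r)
    packing x with x ⊆? J
    ... | yes x⊆J = begin
      1 + ∑[ i < n ] 𝟙 (anchoredAt? i x) ≡⟨ cong suc (∑-𝟙-none (λ i → anchoredAt? i x) not-anchored) ⟩
      1                                  ≡⟨ 𝟙-yes (wP P x ≤? r) (⊆J⇒wP≤r x⊆J) ⟨
      𝟙 (wP P x ≤? r)                    ∎
      where
      open ≤-Reasoning
      not-anchored : ∀ i → ¬ AnchoredAt i x
      not-anchored i (i∈T , i∈x , _) = x∈p─q⇒x∉q i∈T (x⊆J i∈x)
    ... | no _ =
      ∑-𝟙-exclusive (λ i → anchoredAt? i x) (wP P x ≤? r) anchor-unique (λ _ → proj₂ ∘ proj₂ ∘ proj₂)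

    anchored-count : ∀ i → 𝟙 (i ∈? Pr ─ J) * 2 ^ r ≤ 2 * sumWords n (λ x → 𝟙 (anchoredAt? i x))
    anchored-count i = 𝟙*-≤ (i ∈? Pr ─ J) λ i∈T →
      let Q , Q-ideal , ↓i⊆Q , Q⊆↓i∪J , ∣Q∣≡r =
            intermediate-ideal P (↓-isIdeal P ⁅ i ⁆) (∪-isIdeal P (↓-isIdeal P ⁅ i ⁆) J-ideal) (p⊆p∪q J)
                     (∈Pr⇒∣↓⁅⁆∣≤r (p─q⊆p Pr J i∈T)) (subst (_≤ _) ∣J∣≡r (∣q∣≤∣p∪q∣ ((↓ P) ⁅ i ⁆) J))
          anchored : ∀ {x} → i ∈ x × x ⊆ Q → AnchoredAt i x
          anchored (i∈x , x⊆Q) = i∈T , i∈x , Q⊆↓i∪J ∘ x⊆Q , subst (_ ≤_) ∣Q∣≡r (wP≤∣ideal∣ P Q-ideal x⊆Q)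
      in begin
      2 ^ r
        ≡⟨ cong (2 ^_) ∣Q∣≡r ⟨
      2 ^ ∣ Q ∣
        ≡⟨ sumWords-∋-⊆ Q (↓i⊆Q (X⊆↓X P (x∈⁅x⁆ i))) ⟨
      2 * sumWords n (λ x → 𝟙 ((i ∈? x) ×-dec (x ⊆? Q)))
        ≤⟨ *-monoʳ-≤ 2 (sumWords-mono-≤ λ x →
             𝟙-mono ((i ∈? x) ×-dec (x ⊆? Q)) (anchoredAt? i x) anchored) ⟩
      2 * sumWords n (λ x → 𝟙 (anchoredAt? i x))
        ∎
      where open ≤-Reasoning

    [2+∣Pr─J∣]*2^r≤2*ballSize : (2 + ∣ Pr ─ J ∣) * 2 ^ r ≤ 2 * ballSize P r
    [2+∣Pr─J∣]*2^r≤2*ballSize = begin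
      (2 + ∣ Pr ─ J ∣) * 2 ^ r
        ≡⟨ *-distribʳ-+ (2 ^ r) 2 ∣ Pr ─ J ∣ ⟩
      2 * 2 ^ r + ∣ Pr ─ J ∣ * 2 ^ r
        ≡⟨ cong₂ _+_ (cong (2 *_) 2^r≡ΣJ) ∣Pr─J∣*2^r≡∑ ⟩
      2 * ΣJ + ∑[ i < n ] (𝟙 (i ∈? Pr ─ J) * 2 ^ r)
        ≤⟨ +-monoʳ-≤ (2 * ΣJ) (∑-mono-≤ anchored-count) ⟩
      2 * ΣJ + ∑[ i < n ] (2 * Σ i)
        ≡⟨ cong (2 * ΣJ +_) (*-distribˡ-sum 2 Σ) ⟨
      2 * ΣJ + 2 * ∑[ i < n ] Σ i
        ≡⟨ *-distribˡ-+ 2 ΣJ _ ⟨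
      2 * (ΣJ + ∑[ i < n ] Σ i)
        ≡⟨ cong (λ s → 2 * (ΣJ + s)) (sumWords-∑-comm (λ i x → 𝟙 (anchoredAt? i x))) ⟨
      2 * (ΣJ + sumWords n (λ x → ∑[ i < n ] 𝟙 (anchoredAt? i x)))
        ≡⟨ cong (2 *_) (sumWords-distrib-+ n _ _) ⟨
      2 * sumWords n (λ x → 𝟙 (x ⊆? J) + ∑[ i < n ] 𝟙 (anchoredAt? i x))
        ≤⟨ *-monoʳ-≤ 2 (sumWords-mono-≤ packing) ⟩
      2 * ballSize P r
        ∎
      where
      open ≤-Reasoning
      ΣJ : ℕ
      ΣJ = sumWords n (λ x → 𝟙 (x ⊆? J))
      Σ : Fin n → ℕ
      Σ i = sumWords n (λ x → 𝟙 (anchoredAt? i x))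
      2^r≡ΣJ : 2 ^ r ≡ ΣJ
      2^r≡ΣJ = trans (cong (2 ^_) (sym ∣J∣≡r)) (sym (sumWords-⊆ J))
      ∣Pr─J∣*2^r≡∑ : ∣ Pr ─ J ∣ * 2 ^ r ≡ ∑[ i < n ] (𝟙 (i ∈? Pr ─ J) * 2 ^ r)
      ∣Pr─J∣*2^r≡∑ =
        trans (cong (_* 2 ^ r) (∣p∣≡∑𝟙∈ (Pr ─ J))) (*-distribʳ-sum (2 ^ r) (λ i → 𝟙 (i ∈? Pr ─ J)))

  module _ (r≤n : r ≤ n) where

    ideal⊆idealOfSize : ∀ {I} → IsIdeal P I → ∣ I ∣ ≤ r → ∃ λ J → IsIdeal P J × I ⊆ J × ∣ J ∣ ≡ r
    ideal⊆idealOfSize I-ideal ∣I∣≤r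
      with intermediate-ideal P I-ideal (⊤-isIdeal P) ⊆⊤ ∣I∣≤r (subst (r ≤_) (sym (∣⊤∣≡n n)) r≤n)
    ... | J , J-ideal , I⊆J , _ , ∣J∣≡r = J , J-ideal , I⊆J , ∣J∣≡r

    ball⊆Pr : ∀ {x} → wP P x ≤ r → x ⊆ Pr
    ball⊆Pr wx≤r i∈x with ideal⊆idealOfSize (↓-isIdeal P _) wx≤r
    ... | J , J-ideal , ↓x⊆J , ∣J∣≡r = ideal⊆Pr J-ideal ∣J∣≡r (↓x⊆J (X⊆↓X P i∈x))

    𝟙ball≤𝟙⊆Pr : ∀ x → 𝟙 (wP P x ≤? r) ≤ 𝟙 (x ⊆? Pr)
    𝟙ball≤𝟙⊆Pr x = 𝟙-mono (wP P x ≤? r) (x ⊆? Pr) ball⊆Pr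

    ballSize≡2^m⇒m<∣Pr∣ : ∀ {m} → r < m → ballSize P r ≡ 2 ^ m → m < ∣ Pr ∣
    ballSize≡2^m⇒m<∣Pr∣ {m} r<m ballSize≡2^m with wP P Pr ≤? r
    ... | yes wPr≤r = contradiction 2^m≤2^r (<⇒≱ (^-monoʳ-< 2 (s≤s (s≤s z≤n)) r<m))
      where
      open ≤-Reasoning
      2^m≤2^r : 2 ^ m ≤ 2 ^ r
      2^m≤2^r = begin
        2 ^ m                                ≡⟨ ballSize≡2^m ⟨
        ballSize P r                         ≤⟨ sumWords-mono-≤ 𝟙ball≤𝟙⊆Pr ⟩
        sumWords n (λ x → 𝟙 (x ⊆? Pr))       ≡⟨ sumWords-⊆ Pr ⟩
        2 ^ ∣ Pr ∣                           ≤⟨ ^-monoʳ-≤ 2 (≤-trans (p⊆q⇒∣p∣≤∣q∣ (X⊆↓X P)) wPr≤r) ⟩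
        2 ^ r                                ∎
    ... | no wPr≰r = ≰⇒> λ ∣Pr∣≤m → <⇒≱ 2^m<2^∣Pr∣ (^-monoʳ-≤ 2 ∣Pr∣≤m)
      where
      open ≤-Reasoning
      2^m<2^∣Pr∣ : 2 ^ m < 2 ^ ∣ Pr ∣
      2^m<2^∣Pr∣ = begin-strict
        2 ^ m                                ≡⟨ ballSize≡2^m ⟨
        ballSize P r                         <⟨ sumWords-mono-< 𝟙ball≤𝟙⊆Pr Pr strict-at-Pr ⟩
        sumWords n (λ x → 𝟙 (x ⊆? Pr))       ≡⟨ sumWords-⊆ Pr ⟩
        2 ^ ∣ Pr ∣                           ∎
        where
        strict-at-Pr : 𝟙 (wP P Pr ≤? r) < 𝟙 (Pr ⊆? Pr)
        strict-at-Pr rewrite 𝟙-no (wP P Pr ≤? r) wPr≰r | 𝟙-yes (Pr ⊆? Pr) id = z<s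

    [2+∣Pr∣∸r]*2^r≤2*ballSize : (2 + (∣ Pr ∣ ∸ r)) * 2 ^ r ≤ 2 * ballSize P r
    [2+∣Pr∣∸r]*2^r≤2*ballSize =
      let J , J-ideal , _ , ∣J∣≡r = ideal⊆idealOfSize (⊥-isIdeal P) (subst (_≤ r) (sym (∣⊥∣≡0 n)) z≤n)
          ∣Pr─J∣≡∣Pr∣∸r = trans (sym (m+n∸n≡m _ ∣ J ∣))
                                (cong₂ _∸_ (∣p─q∣+∣q∣≡∣p∣ Pr J (ideal⊆Pr J-ideal ∣J∣≡r)) ∣J∣≡r)
      in subst (λ t → (2 + t) * 2 ^ r ≤ 2 * ballSize P r) ∣Pr─J∣≡∣Pr∣∸r
               ([2+∣Pr─J∣]*2^r≤2*ballSize J-ideal ∣J∣≡r)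

[2+l]*2^r≤2*2^m⇒l≤2^[m∸r+1]∸2 : ∀ {l r m} → r ≤ m → (2 + l) * 2 ^ r ≤ 2 * 2 ^ m → l ≤ 2 ^ (m ∸ r + 1) ∸ 2
[2+l]*2^r≤2*2^m⇒l≤2^[m∸r+1]∸2 {l} {r} {m} r≤m bound =
  m+n≤o⇒m≤o∸n l (subst (_≤ 2 ^ (m ∸ r + 1)) (+-comm 2 l)
    (*-cancelʳ-≤ (2 + l) (2 ^ (m ∸ r + 1)) (2 ^ r) {{m^n≢0 2 r}} (begin
      (2 + l) * 2 ^ r       ≤⟨ bound ⟩
      2 ^ suc m             ≡⟨ cong (2 ^_) m∸r+1+r≡1+m ⟨
      2 ^ (m ∸ r + 1 + r)   ≡⟨ ^-distribˡ-+-* 2 (m ∸ r + 1) r ⟩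
      2 ^ (m ∸ r + 1) * 2 ^ r ∎)))
  where
  open ≤-Reasoning
  m∸r+1+r≡1+m : m ∸ r + 1 + r ≡ suc m
  m∸r+1+r≡1+m = begin-equality
    m ∸ r + 1 + r ≡⟨ +-assoc (m ∸ r) 1 r ⟩
    m ∸ r + suc r ≡⟨ +-suc (m ∸ r) r ⟩
    suc (m ∸ r + r) ≡⟨ cong suc (m∸n+n≡m r≤m) ⟩
    suc m ∎

lemma4 : (n : ℕ) (P : FinPoset n) (r m : ℕ) → r < m → m ≤ n →
         (Pr : Subset n) → IsPr P r Pr →
         ∃ (λ (C : List (Word n)) → Unique C × length C ≡ 2 ^ (n ∸ m) × IsPerfect P r C) →
         (m ∸ r < ∣ Pr ∣ ∸ r) × (∣ Pr ∣ ∸ r ≤ 2 ^ (m ∸ r + 1) ∸ 2)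
lemma4 n P r m r<m m≤n Pr isPr (C , unique , ∣C∣≡2^[n∸m] , perfect) =
  ∸-monoˡ-< (ballSize≡2^m⇒m<∣Pr∣ P isPr r≤n r<m ballSize≡2^m) r≤m ,
  [2+l]*2^r≤2*2^m⇒l≤2^[m∸r+1]∸2 r≤m
    (subst (λ B → (2 + (∣ Pr ∣ ∸ r)) * 2 ^ r ≤ 2 * B) ballSize≡2^m
           ([2+∣Pr∣∸r]*2^r≤2*ballSize P isPr r≤n))
  where
  r≤m : r ≤ m
  r≤m = <⇒≤ r<m
  r≤n : r ≤ n
  r≤n = ≤-trans r≤m m≤n
  ballSize≡2^m : ballSize P r ≡ 2 ^ m
  ballSize≡2^m = perfect⇒ballSize≡2^m P r m≤n unique ∣C∣≡2^[n∸m] perfect
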